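{- Let $n\geq 2l$, $l\geq 1$ be integers, $m=n-l$, and $1\leq i\leq l$. Define \begin{align*} S_1&=\sum_{j=0}^l(-1)^j\begin{bmatrix} m+i\\ j\end{bmatrix}_q\begin{bmatrix} m-j\\ m-l\end{bmatrix}_q q^{\binom{l-j+1}2}, & S_2&=\sum_{j=0}^l(-1)^j\begin{bmatrix} m+i\\ j-l+i\end{bmatrix}_q\begin{bmatrix} m-j\\ m-l\end{bmatrix}_q q^{\binom{l-j+1}2},\\ S_3&=\sum_{j=0}^l(-1)^j\begin{bmatrix} m+i\\ j-1\end{bmatrix}_q\begin{bmatrix} m-j\\ m-l\end{bmatrix}_q q^{\binom{l-j+1}2}, & S_4&=\sum_{j=0}^l(-1)^j\begin{bmatrix} m+i\\ j-1-l+i\end{bmatrix}_q\begin{bmatrix} m-j\\ m-l\end{bmatrix}_q q^{\binom{l-j+1}2}. \end{align*} Then \begin{align*} S_1&=(-1)^l\frac{(q^{m+i-l+1};q)_l}{(q;q)_l}\,{}_2\phi_1(q^{ -l},q^{m-l+1};q^{m+i-l+1};q,q^{l+1}),\\ S_2&=(-1)^l\frac{(q^{m+1};q)_i}{(q;q)_i}\,{}_2\phi_1(q^{ -i},q^{m-l+1};q^{m+1};q,q^{i+1}),\\ S_3&=(-1)^l\frac{(q^{m+i-l+2};q)_{l-1}}{(q;q)_{l-1}}\,{}_2\phi_1(q^{1-l},q^{m-l+1};q^{m+i-l+2};q,q^{l}),\\ S_4&=(-1)^l\frac{(q^{m+2};q)_{i-1}}{(q;q)_{i-1}}\,{}_2\phi_1(q^{1-i},q^{m-l+1};q^{m+2};q,q^{i}).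 \end{align*}
   Context: Here $q$ is a prime power (or an indeterminate). The $q$-binomial coefficient is $\begin{bmatrix} a\\ b\end{bmatrix}_q=\frac{(q;q)_a}{(q;q)_b(q;q)_{a-b}}$ for integers $0\leq b\leq a$ and $0$ if $b<0$ or $b>a$. The $q$-Pochhammer symbol is $(a;q)_k=\prod_{r=0}^{k-1}(1-aq^r)$, and $(a,b;q)_k=(a;q)_k(b;q)_k$. Heine's $q$-hypergeometric series is ${}_2\phi_1(a,b;c;q,z)=\sum_{k\geq 0}\frac{(a,b;q)_k}{(q,c;q)_k}z^k$ (all series above terminate since their first parameter is a nonpositive power of $q$). -}

module Defs where

open import Data.Nat as ℕ using (ℕ; zero; suc; _∸_)
open import Data.Nat.Combinatorics using (_C_)
open import Data.Integer as ℤ using (ℤ; +_; -[1+_])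
open import Data.Rational using (ℚ; 0ℚ; 1ℚ; _+_; _*_; -_; _-_; _÷_; ≢-nonZero; _/_)
open import Data.Rational.Properties using (_≟_)
open import Relation.Nullary using (yes; no)

-- total division: x ⊘ 0 = 0 (only ever applied to nonzero denominators here)
infixl 7 _⊘_
_⊘_ : ℚ → ℚ → ℚ
x ⊘ y with y ≟ 0ℚ
... | yes _  = 0ℚ
... | no y≢0 = _÷_ x y {{≢-nonZero y≢0}}

infixr 8 _^_
_^_ : ℚ → ℕ → ℚ
x ^ zero  = 1ℚ
x ^ suc k = x * (x ^ k)

_^ℤ_ : ℚ → ℤ → ℚ
x ^ℤ (+ k)     = x ^ k
x ^ℤ -[1+ k ]  = 1ℚ ⊘ (x ^ suc k)

ℕ→ℚ : ℕ → ℚ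
ℕ→ℚ n = (+ n) / 1

poch : ℚ → ℚ → ℕ → ℚ
poch a q zero    = 1ℚ
poch a q (suc k) = poch a q k * (1ℚ - a * (q ^ k))

qbinℕ : ℚ → ℕ → ℕ → ℚ
qbinℕ q a b with b ℕ.≤? a
... | yes _ = poch q q a ⊘ (poch q q b * poch q q (a ∸ b))
... | no _  = 0ℚ

qbin : ℚ → ℤ → ℤ → ℚ
qbin q (+ a)    (+ b)    = qbinℕ q a b
qbin q (+ a)    -[1+ _ ] = 0ℚ
qbin q -[1+ _ ] (+ b)    = 0ℚ   -- b ≥ 0 > a, so b > a
qbin q -[1+ _ ] -[1+ _ ] = 0ℚ

sumTo : ℕ → (ℕ → ℚ) → ℚ
sumTo zero    f = f zero
sumTo (suc N) f = sumTo N f + f (suc N)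

-- Heine's series with first parameter a = q^{-N}:
-- ₂φ₁(q^{-N}, b; c; q, z) = Σ_{k≥0} (q^{-N},b;q)_k / (q,c;q)_k z^k ;
-- the terms with k > N vanish since (q^{-N};q)_k = 0, so the sum is taken for k = 0..N.
phi21 : ℚ → ℕ → ℚ → ℚ → ℚ → ℚ
phi21 q N b c z =
  sumTo N (λ k → ((poch (q ^ℤ (ℤ.- (+ N))) q k * poch b q k)
                   ⊘ (poch q q k * poch c q k)) * (z ^ k))

sgn : ℕ → ℚ
sgn j = (- 1ℚ) ^ j

-- the summands of S1..S4, with the lower index of the first q-binomial given as an integer
Sgen : ℚ → ℕ → ℕ → ℕ → (ℕ → ℤ) → ℚ
Sgen q l m i low =
  sumTo l (λ j → sgn j * qbin q (+ (m ℕ.+ i)) (low j)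
                       * qbin q (+ m ℤ.- + j) (+ m ℤ.- + l)
                       * (q ^ ((l ∸ j ℕ.+ 1) C 2)))

-- Reversing the order of summation (j = l - k) turns each S_r into a sum over k whose terms
-- vanish as soon as the lower index of the first q-binomial becomes negative, so only
-- k = 0..N survives, with N = l, i, l-1, i-1.  Termwise, both q-binomials are ratios of
-- q-Pochhammer symbols, and (q^{-N};q)_k = (-1)^k q^{C(k,2)-Nk} (q;q)_N / (q;q)_{N-k} turns
-- the k-th term into the k-th term of the 2phi1 series.  Since q > 1 every Pochhammer symbol
-- in a denominator is nonzero, so each termwise identity is checked after clearing them.
{-# OPTIONS --safe #-}
module Submission where

open import Defs
open import Data.Nat as ℕ using (ℕ; zero; suc; _≤_; _∸_)
open import Data.Nat.Primality using (Prime; prime⇒nonTrivial)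
open import Data.Nat.Combinatorics using (_C_; nC1≡n; nCk+nC[k+1]≡[n+1]C[k+1])
import Data.Nat.Properties as ℕₚ
open import Data.Integer as ℤ using (ℤ; +_; _⊖_)
import Data.Integer.Properties as ℤₚ
open import Data.Integer.GCD using (gcd-zeroʳ)
import Data.Integer.Solver as ℤ-Solver
open import Data.Rational as ℚ using (ℚ; 0ℚ; 1ℚ; _*_; _+_; -_; _-_; 1/_; _<_)
import Data.Rational.Properties as ℚₚ
open import Data.Rational.Solver using (module +-*-Solver)
open import Data.Product using (_×_; _,_)
open import Data.Empty using (⊥-elim)
open import Relation.Nullary using (yes; no)
open import Relation.Binary.PropositionalEquality
open ≡-Reasoning

x⊘y*y≡x : ∀ x {y} → y ≢ 0ℚ → (x ⊘ y) * y ≡ x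
x⊘y*y≡x x {y} y≢0 with y ℚₚ.≟ 0ℚ
... | yes y≡0  = ⊥-elim (y≢0 y≡0)
... | no  y≢0′ = begin
  x * 1/ y * y     ≡⟨ ℚₚ.*-assoc x (1/ y) y ⟩
  x * (1/ y * y)   ≡⟨ cong (x *_) (ℚₚ.*-inverseˡ y) ⟩
  x * 1ℚ           ≡⟨ ℚₚ.*-identityʳ x ⟩
  x                ∎
  where instance _ = ℚ.≢-nonZero y≢0′

*-cancelʳ-≡ : ∀ x y {z} → z ≢ 0ℚ → x * z ≡ y * z → x ≡ y
*-cancelʳ-≡ x y {z} z≢0 xz≡yz = begin
  x                 ≡⟨ sym (ℚₚ.*-identityʳ x) ⟩
  x * 1ℚ            ≡⟨ cong (x *_) (sym (ℚₚ.*-inverseʳ z)) ⟩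
  x * (z * 1/ z)    ≡⟨ sym (ℚₚ.*-assoc x z (1/ z)) ⟩
  x * z * 1/ z      ≡⟨ cong (_* 1/ z) xz≡yz ⟩
  y * z * 1/ z      ≡⟨ ℚₚ.*-assoc y z (1/ z) ⟩
  y * (z * 1/ z)    ≡⟨ cong (y *_) (ℚₚ.*-inverseʳ z) ⟩
  y * 1ℚ            ≡⟨ ℚₚ.*-identityʳ y ⟩
  y                 ∎
  where instance _ = ℚ.≢-nonZero z≢0

*-≢0 : ∀ {x y} → x ≢ 0ℚ → y ≢ 0ℚ → x * y ≢ 0ℚ
*-≢0 {x} {y} x≢0 y≢0 xy≡0 =
  y≢0 (*-cancelʳ-≡ y 0ℚ x≢0 (trans (ℚₚ.*-comm y x) (trans xy≡0 (sym (ℚₚ.*-zeroˡ x)))))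

1<x⇒1-x≢0 : ∀ {x} → 1ℚ < x → 1ℚ - x ≢ 0ℚ
1<x⇒1-x≢0 {x} 1<x 1-x≡0 = ℚₚ.<-irrefl (sym x≡1) 1<x
  where
  x≡1 : x ≡ 1ℚ
  x≡1 = begin
    x                ≡⟨ sym (ℚₚ.+-identityˡ x) ⟩
    0ℚ + x           ≡⟨ cong (_+ x) (sym 1-x≡0) ⟩
    1ℚ - x + x       ≡⟨ ℚₚ.+-assoc 1ℚ (- x) x ⟩
    1ℚ + (- x + x)   ≡⟨ cong (λ y → 1ℚ + y) (ℚₚ.+-inverseˡ x) ⟩
    1ℚ + 0ℚ          ≡⟨ ℚₚ.+-identityʳ 1ℚ ⟩
    1ℚ               ∎

^-distribˡ-+-* : ∀ x m n → x ^ (m ℕ.+ n) ≡ x ^ m * x ^ n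
^-distribˡ-+-* x zero    n = sym (ℚₚ.*-identityˡ (x ^ n))
^-distribˡ-+-* x (suc m) n =
  trans (cong (x *_) (^-distribˡ-+-* x m n)) (sym (ℚₚ.*-assoc x (x ^ m) (x ^ n)))

^-distribʳ-* : ∀ x y n → (x * y) ^ n ≡ x ^ n * y ^ n
^-distribʳ-* x y zero    = sym (ℚₚ.*-identityˡ 1ℚ)
^-distribʳ-* x y (suc n) = begin
  x * y * (x * y) ^ n        ≡⟨ cong (x * y *_) (^-distribʳ-* x y n) ⟩
  x * y * (x ^ n * y ^ n)    ≡⟨ solve 4 (λ a b c d → (a :* b) :* (c :* d) := (a :* c) :* (b :* d))
                                  refl x y (x ^ n) (y ^ n) ⟩
  x * x ^ n * (y * y ^ n)    ∎
  where open +-*-Solver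

^-[1+k]C2 : ∀ x k → x ^ (suc k C 2) ≡ x ^ k * x ^ (k C 2)
^-[1+k]C2 x k = begin
  x ^ (suc k C 2)           ≡⟨ cong (x ^_) (sym (nCk+nC[k+1]≡[n+1]C[k+1] k 1)) ⟩
  x ^ (k C 1 ℕ.+ k C 2)     ≡⟨ cong (λ n → x ^ (n ℕ.+ k C 2)) (nC1≡n k) ⟩
  x ^ (k ℕ.+ k C 2)         ≡⟨ ^-distribˡ-+-* x k (k C 2) ⟩
  x ^ k * x ^ (k C 2)       ∎

sumTo-cong : ∀ N {g h : ℕ → ℚ} → (∀ k → k ≤ N → g k ≡ h k) → sumTo N g ≡ sumTo N h
sumTo-cong zero    g≡h = g≡h 0 ℕ.z≤n
sumTo-cong (suc N) g≡h =
  cong₂ _+_ (sumTo-cong N (λ k k≤N → g≡h k (ℕₚ.m≤n⇒m≤1+n k≤N))) (g≡h (suc N) ℕₚ.≤-refl)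

sumTo-suc : ∀ N (g : ℕ → ℚ) → sumTo (suc N) g ≡ g 0 + sumTo N (λ k → g (suc k))
sumTo-suc zero    g = refl
sumTo-suc (suc N) g =
  trans (cong (_+ g (suc (suc N))) (sumTo-suc N g)) (ℚₚ.+-assoc (g 0) _ _)

sumTo-reverse : ∀ N (g : ℕ → ℚ) → sumTo N g ≡ sumTo N (λ k → g (N ∸ k))
sumTo-reverse zero    g = refl
sumTo-reverse (suc N) g = begin
  sumTo N g + g (suc N)                       ≡⟨ cong (_+ g (suc N)) (sumTo-reverse N g) ⟩
  sumTo N (λ k → g (N ∸ k)) + g (suc N)       ≡⟨ ℚₚ.+-comm _ (g (suc N)) ⟩
  g (suc N) + sumTo N (λ k → g (N ∸ k))       ≡⟨ sym (sumTo-suc N (λ k → g (suc N ∸ k))) ⟩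
  sumTo (suc N) (λ k → g (suc N ∸ k))         ∎

sumTo-+-vanishing : ∀ N d (g : ℕ → ℚ) → (∀ k → N ℕ.< k → k ≤ N ℕ.+ d → g k ≡ 0ℚ) →
                    sumTo (N ℕ.+ d) g ≡ sumTo N g
sumTo-+-vanishing N zero    g g≡0 = cong (λ n → sumTo n g) (ℕₚ.+-identityʳ N)
sumTo-+-vanishing N (suc d) g g≡0 rewrite ℕₚ.+-suc N d = begin
  sumTo (N ℕ.+ d) g + g (suc (N ℕ.+ d))
    ≡⟨ cong₂ _+_ (sumTo-+-vanishing N d g (λ k N<k k≤ → g≡0 k N<k (ℕₚ.m≤n⇒m≤1+n k≤)))
                 (g≡0 (suc (N ℕ.+ d)) (ℕ.s≤s (ℕₚ.m≤m+n N d)) ℕₚ.≤-refl) ⟩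
  sumTo N g + 0ℚ
    ≡⟨ ℚₚ.+-identityʳ _ ⟩
  sumTo N g ∎

*-distribˡ-sumTo : ∀ c N (g : ℕ → ℚ) → c * sumTo N g ≡ sumTo N (λ k → c * g k)
*-distribˡ-sumTo c zero    g = refl
*-distribˡ-sumTo c (suc N) g =
  trans (ℚₚ.*-distribˡ-+ c _ _) (cong (_+ c * g (suc N)) (*-distribˡ-sumTo c N g))

poch-+ : ∀ x q a k → poch x q (a ℕ.+ k) ≡ poch x q a * poch (x * q ^ a) q k
poch-+ x q a zero =
  trans (cong (poch x q) (ℕₚ.+-identityʳ a)) (sym (ℚₚ.*-identityʳ (poch x q a)))
poch-+ x q a (suc k) = begin
  poch x q (a ℕ.+ suc k)
    ≡⟨ cong (poch x q) (ℕₚ.+-suc a k) ⟩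
  poch x q (a ℕ.+ k) * (1ℚ - x * q ^ (a ℕ.+ k))
    ≡⟨ cong₂ (λ u v → u * (1ℚ - x * v)) (poch-+ x q a k) (^-distribˡ-+-* q a k) ⟩
  poch x q a * poch (x * q ^ a) q k * (1ℚ - x * (q ^ a * q ^ k))
    ≡⟨ solve 5 (λ P Q x y z → P :* Q :* (con 1ℚ :- x :* (y :* z)) := P :* (Q :* (con 1ℚ :- x :* y :* z)))
         refl (poch x q a) (poch (x * q ^ a) q k) x (q ^ a) (q ^ k) ⟩
  poch x q a * poch (x * q ^ a) q (suc k) ∎
  where open +-*-Solver

qbinℕ-*-denominator : ∀ q {a b} → b ≤ a → poch q q b * poch q q (a ∸ b) ≢ 0ℚ →
                      qbinℕ q a b * (poch q q b * poch q q (a ∸ b)) ≡ poch q q a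
qbinℕ-*-denominator q {a} {b} b≤a d≢0 with b ℕ.≤? a
... | yes _   = x⊘y*y≡x _ d≢0
... | no  b≰a = ⊥-elim (b≰a b≤a)

-- Sgen q l m i low and phi21 q N b c z unfold to sumTo l (λ j → summand q (m + i) m l (low j) j)
-- and sumTo N (phi21-term q N b c z).
summand : ℚ → ℕ → ℕ → ℕ → ℤ → ℕ → ℚ
summand q M m l b j =
  sgn j * qbin q (+ M) b * qbin q (+ m ℤ.- + j) (+ m ℤ.- + l) * q ^ ((l ∸ j ℕ.+ 1) C 2)

phi21-term : ℚ → ℕ → ℚ → ℚ → ℚ → ℕ → ℚ
phi21-term q N b c z k =
  ((poch (q ^ℤ (ℤ.- (+ N))) q k * poch b q k) ⊘ (poch q q k * poch c q k)) * (z ^ k)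

summand-negative : ∀ q M m l {d} → 0 ℕ.< d → ∀ j → summand q M m l (ℤ.- (+ d)) j ≡ 0ℚ
summand-negative q M m l {suc _} _ j = begin
  sgn j * 0ℚ * B * E      ≡⟨ solve 3 (λ s B E → s :* con 0ℚ :* B :* E := con 0ℚ) refl (sgn j) B E ⟩
  0ℚ                      ∎
  where
  open +-*-Solver
  B = qbin q (+ m ℤ.- + j) (+ m ℤ.- + l)
  E = q ^ ((l ∸ j ℕ.+ 1) C 2)

+m-+n≡+[m∸n] : ∀ {m n} → n ≤ m → + m ℤ.- + n ≡ + (m ∸ n)
+m-+n≡+[m∸n] {m} {n} n≤m = trans (ℤₚ.[+m]-[+n]≡m⊖n m n) (ℤₚ.⊖-≥ n≤m)

m+[n+o]∸n≡m+o : ∀ m n o → m ℕ.+ (n ℕ.+ o) ∸ n ≡ m ℕ.+ o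
m+[n+o]∸n≡m+o m n o = begin
  m ℕ.+ (n ℕ.+ o) ∸ n     ≡⟨ cong (_∸ n) (ℕₚ.+-assoc m n o) ⟨
  m ℕ.+ n ℕ.+ o ∸ n       ≡⟨ cong (λ x → x ℕ.+ o ∸ n) (ℕₚ.+-comm m n) ⟩
  n ℕ.+ m ℕ.+ o ∸ n       ≡⟨ cong (_∸ n) (ℕₚ.+-assoc n m o) ⟩
  n ℕ.+ (m ℕ.+ o) ∸ n     ≡⟨ ℕₚ.m+n∸m≡n n (m ℕ.+ o) ⟩
  m ℕ.+ o                 ∎

m+n∸n+1≡1+m : ∀ m n → m ℕ.+ n ∸ n ℕ.+ 1 ≡ suc m
m+n∸n+1≡1+m m n = trans (cong (ℕ._+ 1) (ℕₚ.m+n∸n≡m m n)) (ℕₚ.+-comm m 1)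

summand-reindexed : ∀ q a A t s k →
  let j = t ℕ.+ s ; l = j ℕ.+ k in
  summand q (A ℕ.+ (t ℕ.+ k)) (a ℕ.+ l) l (j ⊖ s) j
    ≡ sgn j * qbinℕ q (A ℕ.+ (t ℕ.+ k)) t * qbinℕ q (a ℕ.+ k) a * q ^ (suc k C 2)
summand-reindexed q a A t s k =
  cong₂ _*_ (cong₂ (λ b B → sgn j * qbin q (+ M) b * B) lower≡ (cong₂ (qbin q) upper≡ bottom≡))
            (cong (λ e → q ^ (e C 2)) exponent≡)
  where
  M = A ℕ.+ (t ℕ.+ k)
  j = t ℕ.+ s
  l = j ℕ.+ k
  lower≡ : j ⊖ s ≡ + t
  lower≡ = trans (ℤₚ.⊖-≥ (ℕₚ.m≤n+m s t)) (cong +_ (ℕₚ.m+n∸n≡m t s))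
  upper≡ : + (a ℕ.+ l) ℤ.- + j ≡ + (a ℕ.+ k)
  upper≡ = trans (+m-+n≡+[m∸n] (ℕₚ.≤-trans (ℕₚ.m≤m+n j k) (ℕₚ.m≤n+m l a)))
                 (cong +_ (m+[n+o]∸n≡m+o a j k))
  bottom≡ : + (a ℕ.+ l) ℤ.- + l ≡ + a
  bottom≡ = trans (+m-+n≡+[m∸n] (ℕₚ.m≤n+m l a)) (cong +_ (ℕₚ.m+n∸n≡m a l))
  exponent≡ : l ∸ j ℕ.+ 1 ≡ suc k
  exponent≡ = trans (cong (ℕ._+ 1) (ℕₚ.m+n∸m≡n j k)) (ℕₚ.+-comm k 1)

module _ (q : ℚ) (1<q : 1ℚ < q) where

  private instance
    q-positive : ℚ.Positive q
    q-positive = ℚ.positive (ℚₚ.<-trans (ℚₚ.positive⁻¹ 1ℚ) 1<q)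

  q! : ℕ → ℚ
  q! = poch q q

  q⁻ : ℕ → ℚ
  q⁻ N = q ^ℤ (ℤ.- (+ N))

  1<q^suc : ∀ t → 1ℚ < q ^ suc t
  1<q^suc zero    = subst (1ℚ <_) (sym (ℚₚ.*-identityʳ q)) 1<q
  1<q^suc (suc t) = ℚₚ.<-trans 1<q
    (subst (_< q * q ^ suc t) (ℚₚ.*-identityʳ q) (ℚₚ.*-monoʳ-<-pos q (1<q^suc t)))

  q^≢0 : ∀ t → q ^ t ≢ 0ℚ
  q^≢0 zero    = ℚₚ.1≢0
  q^≢0 (suc t) q^≡0 = ℚₚ.<-irrefl (sym q^≡0) (ℚₚ.<-trans (ℚₚ.positive⁻¹ 1ℚ) (1<q^suc t))

  q⁻*q^≡1 : ∀ N → q⁻ N * q ^ N ≡ 1ℚ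
  q⁻*q^≡1 zero    = ℚₚ.*-identityˡ 1ℚ
  q⁻*q^≡1 (suc N) = x⊘y*y≡x 1ℚ (q^≢0 (suc N))

  poch-≢0 : ∀ x k → (∀ r → 1ℚ < x * q ^ r) → poch x q k ≢ 0ℚ
  poch-≢0 x zero    _    = ℚₚ.1≢0
  poch-≢0 x (suc k) 1<xq = *-≢0 (poch-≢0 x k 1<xq) (1<x⇒1-x≢0 (1<xq k))

  q!-≢0 : ∀ k → q! k ≢ 0ℚ
  q!-≢0 k = poch-≢0 q k 1<q^suc

  poch-q^suc-≢0 : ∀ b k → poch (q ^ suc b) q k ≢ 0ℚ
  poch-q^suc-≢0 b k = poch-≢0 (q ^ suc b) k
    (λ r → subst (1ℚ <_) (^-distribˡ-+-* q (suc b) r) (1<q^suc (b ℕ.+ r)))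

  q!-+ : ∀ a k → q! (a ℕ.+ k) ≡ q! a * poch (q ^ suc a) q k
  q!-+ = poch-+ q q

  -- (q^{-N};q)_k = (-1)^k q^{C(k,2) - Nk} (q;q)_N / (q;q)_{N-k}, with denominators cleared.
  poch-q⁻ : ∀ N k t → t ℕ.+ k ≡ N →
            sgn k * (poch (q⁻ N) q k * (q ^ N) ^ k * q! t) ≡ q ^ (k C 2) * q! N
  poch-q⁻ N zero t refl = begin
    1ℚ * (1ℚ * 1ℚ * q! t)   ≡⟨ solve 1 (λ x → con 1ℚ :* (con 1ℚ :* con 1ℚ :* x) := con 1ℚ :* x) refl (q! t) ⟩
    1ℚ * q! t               ≡⟨ cong (λ n → 1ℚ * q! n) (sym (ℕₚ.+-identityʳ t)) ⟩
    1ℚ * q! (t ℕ.+ 0)       ∎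
    where open +-*-Solver
  poch-q⁻ N (suc k) t t+[1+k]≡N = *-cancelʳ-≡ _ _ (1<x⇒1-x≢0 (1<q^suc t)) (begin
    - 1ℚ * sgn k * (poch c q k * (1ℚ - c * r) * (X * X ^ k) * q! t) * (1ℚ - u)
      ≡⟨ solve 8 (λ S P Y F c X r u →
           :- con 1ℚ :* S :* (P :* (con 1ℚ :- c :* r) :* (X :* Y) :* F) :* (con 1ℚ :- u)
           := :- (S :* (P :* Y :* (F :* (con 1ℚ :- u)))) :* (X :- c :* X :* r))
         refl (sgn k) (poch c q k) (X ^ k) (q! t) c X r u ⟩
    - (sgn k * (poch c q k * X ^ k * q! (suc t))) * (X - c * X * r)
      ≡⟨ cong₂ (λ a b → - a * (X - b * r)) IH (q⁻*q^≡1 N) ⟩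
    - (q ^ (k C 2) * q! N) * (X - 1ℚ * r)
      ≡⟨ cong (λ x → - (q ^ (k C 2) * q! N) * (x - 1ℚ * r)) X≡r*u ⟩
    - (q ^ (k C 2) * q! N) * (r * u - 1ℚ * r)
      ≡⟨ solve 4 (λ g F r u → :- (g :* F) :* (r :* u :- con 1ℚ :* r) := r :* g :* F :* (con 1ℚ :- u))
           refl (q ^ (k C 2)) (q! N) r u ⟩
    r * q ^ (k C 2) * q! N * (1ℚ - u)
      ≡⟨ cong (λ x → x * q! N * (1ℚ - u)) (sym (^-[1+k]C2 q k)) ⟩
    q ^ (suc k C 2) * q! N * (1ℚ - u) ∎)
    where
    open +-*-Solver
    c = q⁻ N
    X = q ^ N
    r = q ^ k
    u = q ^ suc t
    IH : sgn k * (poch c q k * X ^ k * q! (suc t)) ≡ q ^ (k C 2) * q! N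
    IH = poch-q⁻ N k (suc t) (trans (sym (ℕₚ.+-suc t k)) t+[1+k]≡N)
    X≡r*u : X ≡ r * u
    X≡r*u = trans (cong (q ^_) (trans (sym t+[1+k]≡N) (ℕₚ.+-comm t (suc k))))
                  (trans (cong (q ^_) (sym (ℕₚ.+-suc k t))) (^-distribˡ-+-* q k (suc t)))

  reindexed-summand≡phi21-term : ∀ a A t k j →
    let N = t ℕ.+ k in
    sgn j * qbinℕ q (A ℕ.+ N) t * qbinℕ q (a ℕ.+ k) a * q ^ (suc k C 2)
      ≡ sgn (j ℕ.+ k) * (poch (q ^ suc A) q N ⊘ q! N)
        * phi21-term q N (q ^ suc a) (q ^ suc A) (q ^ suc N) k
  reindexed-summand≡phi21-term a A t k j = *-cancelʳ-≡ _ _ D≢0 (trans lhs*D≡ (sym rhs*D≡))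
    where
    open +-*-Solver
    N = t ℕ.+ k
    r = q ^ k
    g = q ^ (k C 2)
    X = (q ^ N) ^ k
    π = poch (q⁻ N) q k
    PAk = poch (q ^ suc A) q k
    PAN = poch (q ^ suc A) q N
    Pak = poch (q ^ suc a) q k
    u₁ = qbinℕ q (A ℕ.+ N) t
    u₂ = qbinℕ q (a ℕ.+ k) a
    c₁ = PAN ⊘ q! N
    c₂ = (π * Pak) ⊘ (q! k * PAk)
    D = q! t * PAk * q! k * q! N
    D≢0 : D ≢ 0ℚ
    D≢0 = *-≢0 (*-≢0 (*-≢0 (q!-≢0 t) (poch-q^suc-≢0 A k)) (q!-≢0 k)) (q!-≢0 N)
    binom₁ : u₁ * (q! t * PAk) ≡ PAN
    binom₁ = *-cancelʳ-≡ _ _ (q!-≢0 A) (begin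
      u₁ * (q! t * PAk) * q! A
        ≡⟨ solve 4 (λ u F P G → u :* (F :* P) :* G := u :* (F :* (G :* P))) refl u₁ (q! t) PAk (q! A) ⟩
      u₁ * (q! t * (q! A * PAk))
        ≡⟨ cong (λ x → u₁ * (q! t * x)) (trans (sym (q!-+ A k)) (cong q! (sym (m+[n+o]∸n≡m+o A t k)))) ⟩
      u₁ * (q! t * q! (A ℕ.+ N ∸ t))
        ≡⟨ qbinℕ-*-denominator q (ℕₚ.≤-trans (ℕₚ.m≤m+n t k) (ℕₚ.m≤n+m N A))
             (*-≢0 (q!-≢0 t) (q!-≢0 (A ℕ.+ N ∸ t))) ⟩
      q! (A ℕ.+ N)
        ≡⟨ trans (q!-+ A N) (ℚₚ.*-comm (q! A) PAN) ⟩
      PAN * q! A ∎)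
    binom₂ : u₂ * q! k ≡ Pak
    binom₂ = *-cancelʳ-≡ _ _ (q!-≢0 a) (begin
      u₂ * q! k * q! a
        ≡⟨ solve 3 (λ u F G → u :* F :* G := u :* (G :* F)) refl u₂ (q! k) (q! a) ⟩
      u₂ * (q! a * q! k)
        ≡⟨ cong (λ n → u₂ * (q! a * q! n)) (sym (ℕₚ.m+n∸m≡n a k)) ⟩
      u₂ * (q! a * q! (a ℕ.+ k ∸ a))
        ≡⟨ qbinℕ-*-denominator q (ℕₚ.m≤m+n a k) (*-≢0 (q!-≢0 a) (q!-≢0 (a ℕ.+ k ∸ a))) ⟩
      q! (a ℕ.+ k)
        ≡⟨ trans (q!-+ a k) (ℚₚ.*-comm (q! a) Pak) ⟩
      Pak * q! a ∎)
    lhs*D≡ : sgn j * u₁ * u₂ * q ^ (suc k C 2) * D ≡ sgn j * r * g * PAN * Pak * q! N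
    lhs*D≡ = begin
      sgn j * u₁ * u₂ * q ^ (suc k C 2) * D
        ≡⟨ cong (λ x → sgn j * u₁ * u₂ * x * D) (^-[1+k]C2 q k) ⟩
      sgn j * u₁ * u₂ * (r * g) * D
        ≡⟨ solve 9 (λ s u₁ u₂ r g F P K M → s :* u₁ :* u₂ :* (r :* g) :* (F :* P :* K :* M)
                      := s :* r :* g :* (u₁ :* (F :* P)) :* (u₂ :* K) :* M)
             refl (sgn j) u₁ u₂ r g (q! t) PAk (q! k) (q! N) ⟩
      sgn j * r * g * (u₁ * (q! t * PAk)) * (u₂ * q! k) * q! N
        ≡⟨ cong₂ (λ x y → sgn j * r * g * x * y * q! N) binom₁ binom₂ ⟩
      sgn j * r * g * PAN * Pak * q! N ∎
    rhs*D≡ : sgn (j ℕ.+ k) * c₁ * (c₂ * (q ^ suc N) ^ k) * D ≡ sgn j * r * g * PAN * Pak * q! N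
    rhs*D≡ = begin
      sgn (j ℕ.+ k) * c₁ * (c₂ * (q ^ suc N) ^ k) * D
        ≡⟨ cong₂ (λ x y → x * c₁ * (c₂ * y) * D) (^-distribˡ-+-* (- 1ℚ) j k) (^-distribʳ-* q (q ^ N) k) ⟩
      sgn j * sgn k * c₁ * (c₂ * (r * X)) * D
        ≡⟨ solve 10 (λ s σ c₁ c₂ r X F P K M → s :* σ :* c₁ :* (c₂ :* (r :* X)) :* (F :* P :* K :* M)
                      := s :* r :* (c₁ :* M) :* (c₂ :* (K :* P)) :* (σ :* X :* F))
             refl (sgn j) (sgn k) c₁ c₂ r X (q! t) PAk (q! k) (q! N) ⟩
      sgn j * r * (c₁ * q! N) * (c₂ * (q! k * PAk)) * (sgn k * X * q! t)
        ≡⟨ cong₂ (λ x y → sgn j * r * x * y * (sgn k * X * q! t))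
             (x⊘y*y≡x PAN (q!-≢0 N)) (x⊘y*y≡x (π * Pak) (*-≢0 (q!-≢0 k) (poch-q^suc-≢0 A k))) ⟩
      sgn j * r * PAN * (π * Pak) * (sgn k * X * q! t)
        ≡⟨ solve 8 (λ s r A π P σ X F → s :* r :* A :* (π :* P) :* (σ :* X :* F)
                     := s :* r :* A :* P :* (σ :* (π :* X :* F)))
             refl (sgn j) r PAN π Pak (sgn k) X (q! t) ⟩
      sgn j * r * PAN * Pak * (sgn k * (π * X * q! t))
        ≡⟨ cong (sgn j * r * PAN * Pak *_) (poch-q⁻ N k t refl) ⟩
      sgn j * r * PAN * Pak * (g * q! N)
        ≡⟨ solve 6 (λ s r A P g M → s :* r :* A :* P :* (g :* M) := s :* r :* g :* A :* P :* M)
             refl (sgn j) r PAN Pak g (q! N) ⟩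
      sgn j * r * g * PAN * Pak * q! N ∎

  summand≡phi21-term : ∀ {M m l N j} a A t s k →
    M ≡ A ℕ.+ N → m ≡ a ℕ.+ l → l ≡ j ℕ.+ k → j ≡ t ℕ.+ s → N ≡ t ℕ.+ k →
    summand q M m l (j ⊖ s) j
      ≡ sgn l * (poch (q ^ (M ∸ N ℕ.+ 1)) q N ⊘ q! N)
        * phi21-term q N (q ^ (m ∸ l ℕ.+ 1)) (q ^ (M ∸ N ℕ.+ 1)) (q ^ (N ℕ.+ 1)) k
  summand≡phi21-term {l = l} {N} a A t s k refl refl refl refl refl = begin
    summand q (A ℕ.+ N) (a ℕ.+ l) l ((t ℕ.+ s) ⊖ s) (t ℕ.+ s)
      ≡⟨ summand-reindexed q a A t s k ⟩
    sgn (t ℕ.+ s) * qbinℕ q (A ℕ.+ N) t * qbinℕ q (a ℕ.+ k) a * q ^ (suc k C 2)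
      ≡⟨ reindexed-summand≡phi21-term a A t k (t ℕ.+ s) ⟩
    rhs (suc a) (suc A) (suc N)
      ≡⟨ sym (cong₂ (λ α β → rhs α β (suc N)) (m+n∸n+1≡1+m a l) (m+n∸n+1≡1+m A N)) ⟩
    rhs (a ℕ.+ l ∸ l ℕ.+ 1) (A ℕ.+ N ∸ N ℕ.+ 1) (suc N)
      ≡⟨ cong (rhs (a ℕ.+ l ∸ l ℕ.+ 1) (A ℕ.+ N ∸ N ℕ.+ 1)) (ℕₚ.+-comm 1 N) ⟩
    rhs (a ℕ.+ l ∸ l ℕ.+ 1) (A ℕ.+ N ∸ N ℕ.+ 1) (N ℕ.+ 1) ∎
    where
    rhs : ℕ → ℕ → ℕ → ℚ
    rhs α β ν = sgn l * (poch (q ^ β) q N ⊘ q! N) * phi21-term q N (q ^ α) (q ^ β) (q ^ ν) k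

  Sgen≡phi21 : ∀ {l m i c z} (low : ℕ → ℤ) s N →
    N ℕ.+ s ≡ l → l ≤ m → (∀ j → low j ≡ j ⊖ s) → c ≡ m ℕ.+ i ∸ N ℕ.+ 1 → z ≡ N ℕ.+ 1 →
    Sgen q l m i low ≡ sgn l * (poch (q ^ c) q N ⊘ q! N) * phi21 q N (q ^ (m ∸ l ℕ.+ 1)) (q ^ c) (q ^ z)
  Sgen≡phi21 {l} {m} {i} low s N refl l≤m low≡ refl refl = begin
    Sgen q l m i low
      ≡⟨ sumTo-cong l (λ j _ → cong (λ b → summand q M m l b j) (low≡ j)) ⟩
    sumTo l T
      ≡⟨ sumTo-reverse l T ⟩
    sumTo (N ℕ.+ s) (λ k → T (l ∸ k))
      ≡⟨ sumTo-+-vanishing N s _ tail≡0 ⟩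
    sumTo N (λ k → T (l ∸ k))
      ≡⟨ sumTo-cong N termwise ⟩
    sumTo N (λ k → coeff * φ k)
      ≡⟨ sym (*-distribˡ-sumTo coeff N φ) ⟩
    coeff * sumTo N φ ∎
    where
    M = m ℕ.+ i
    T : ℕ → ℚ
    T j = summand q M m l (j ⊖ s) j
    coeff = sgn l * (poch (q ^ (M ∸ N ℕ.+ 1)) q N ⊘ q! N)
    φ = phi21-term q N (q ^ (m ∸ l ℕ.+ 1)) (q ^ (M ∸ N ℕ.+ 1)) (q ^ (N ℕ.+ 1))
    tail≡0 : ∀ k → N ℕ.< k → k ≤ l → T (l ∸ k) ≡ 0ℚ
    tail≡0 k N<k k≤l =
      trans (cong (λ b → summand q M m l b j) (ℤₚ.⊖-< j<s)) (summand-negative q M m l (ℕₚ.m<n⇒0<n∸m j<s) j)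
      where
      j = l ∸ k
      j<s : j ℕ.< s
      j<s = subst (j ℕ.<_) (ℕₚ.m+n∸m≡n N s) (ℕₚ.∸-monoʳ-< N<k k≤l)
    termwise : ∀ k → k ≤ N → T (l ∸ k) ≡ coeff * φ k
    termwise k k≤N = summand≡phi21-term (m ∸ l) (M ∸ N) (N ∸ k) s k
      (sym (ℕₚ.m∸n+n≡m N≤M)) (sym (ℕₚ.m∸n+n≡m l≤m))
      (sym (ℕₚ.m∸n+n≡m (ℕₚ.≤-trans k≤N (ℕₚ.m≤m+n N s)))) (ℕₚ.+-∸-comm s k≤N) (sym (ℕₚ.m∸n+n≡m k≤N))
      where
      N≤M : N ≤ M
      N≤M = ℕₚ.≤-trans (ℕₚ.≤-trans (ℕₚ.m≤m+n N s) l≤m) (ℕₚ.m≤m+n m i)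

x∸n+2≡x∸[n∸1]+1 : ∀ {x n} → 1 ≤ n → n ≤ x → x ∸ n ℕ.+ 2 ≡ x ∸ (n ∸ 1) ℕ.+ 1
x∸n+2≡x∸[n∸1]+1 {suc x} {suc zero}    _ _            = ℕₚ.+-suc x 1
x∸n+2≡x∸[n∸1]+1 {suc x} {suc (suc n)} _ (ℕ.s≤s n≤x) = x∸n+2≡x∸[n∸1]+1 (ℕ.s≤s ℕ.z≤n) n≤x

x-l+i≡x-[l∸i] : ∀ x {l i} → i ≤ l → x ℤ.- + l ℤ.+ + i ≡ x ℤ.- + (l ∸ i)
x-l+i≡x-[l∸i] x {l} {i} i≤l = begin
  x ℤ.- + l ℤ.+ + i                         ≡⟨ cong (λ y → x ℤ.- y ℤ.+ + i) +l≡ ⟩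
  x ℤ.- (+ (l ∸ i) ℤ.+ + i) ℤ.+ + i         ≡⟨ solve 3 (λ x a b → x :- (a :+ b) :+ b := x :- a) refl x (+ (l ∸ i)) (+ i) ⟩
  x ℤ.- + (l ∸ i)                           ∎
  where
  open ℤ-Solver.+-*-Solver
  +l≡ : + l ≡ + (l ∸ i) ℤ.+ + i
  +l≡ = trans (cong +_ (sym (ℕₚ.m∸n+n≡m i≤l))) (ℤₚ.pos-+ (l ∸ i) i)

+j-l+i≡j⊖[l∸i] : ∀ j {l i} → i ≤ l → + j ℤ.- + l ℤ.+ + i ≡ j ⊖ (l ∸ i)
+j-l+i≡j⊖[l∸i] j {l} {i} i≤l = trans (x-l+i≡x-[l∸i] (+ j) i≤l) (ℤₚ.[+m]-[+n]≡m⊖n j (l ∸ i))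

+j-1-l+i≡j⊖[1+l∸i] : ∀ j {l i} → i ≤ l → + j ℤ.- + 1 ℤ.- + l ℤ.+ + i ≡ j ⊖ (1 ℕ.+ (l ∸ i))
+j-1-l+i≡j⊖[1+l∸i] j {l} {i} i≤l = begin
  + j ℤ.- + 1 ℤ.- + l ℤ.+ + i        ≡⟨ x-l+i≡x-[l∸i] (+ j ℤ.- + 1) i≤l ⟩
  + j ℤ.- + 1 ℤ.- + (l ∸ i)          ≡⟨ solve 3 (λ x a b → x :- a :- b := x :- (a :+ b)) refl (+ j) (+ 1) (+ (l ∸ i)) ⟩
  + j ℤ.- (+ 1 ℤ.+ + (l ∸ i))        ≡⟨ cong (λ y → + j ℤ.- y) (ℤₚ.pos-+ 1 (l ∸ i)) ⟨
  + j ℤ.- + (1 ℕ.+ (l ∸ i))          ≡⟨ ℤₚ.[+m]-[+n]≡m⊖n j (1 ℕ.+ (l ∸ i)) ⟩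
  j ⊖ (1 ℕ.+ (l ∸ i))                ∎
  where open ℤ-Solver.+-*-Solver

1<n⇒1<ℕ→ℚn : ∀ {n} → 1 ℕ.< n → 1ℚ < ℕ→ℚ n
1<n⇒1<ℕ→ℚn {n} 1<n = ℚ.*<* (subst₂ ℤ._<_ (sym (cong (ℚ.↥ 1ℚ ℤ.*_) ↧x≡1)) (sym ↥x*1≡n) (ℤ.+<+ 1<n))
  where
  x = ℕ→ℚ n
  ↥x≡n : ℚ.↥ x ≡ + n
  ↥x≡n = trans (sym (ℤₚ.*-identityʳ (ℚ.↥ x)))
               (trans (cong (ℚ.↥ x ℤ.*_) (sym (gcd-zeroʳ (+ n)))) (ℚₚ.↥-/ (+ n) 1))
  ↧x≡1 : ℚ.↧ x ≡ + 1
  ↧x≡1 = trans (sym (ℤₚ.*-identityʳ (ℚ.↧ x)))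
               (trans (cong (ℚ.↧ x ℤ.*_) (sym (gcd-zeroʳ (+ n)))) (ℚₚ.↧-/ (+ n) 1))
  ↥x*1≡n : ℚ.↥ x ℤ.* ℚ.↧ 1ℚ ≡ + n
  ↥x*1≡n = trans (ℤₚ.*-identityʳ (ℚ.↥ x)) ↥x≡n

lemma5p1 : (p e : ℕ) → Prime p → 1 ≤ e →
    (n l i : ℕ) → 1 ≤ l → 2 ℕ.* l ≤ n → 1 ≤ i → i ≤ l →
    let q = ℕ→ℚ (p ℕ.^ e)
        m = n ∸ l
    in (Sgen q l m i (λ j → + j)
          ≡ sgn l * (poch (q ^ (m ℕ.+ i ∸ l ℕ.+ 1)) q l ⊘ poch q q l)
              * phi21 q l (q ^ (m ∸ l ℕ.+ 1)) (q ^ (m ℕ.+ i ∸ l ℕ.+ 1)) (q ^ (l ℕ.+ 1)))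
     × (Sgen q l m i (λ j → + j ℤ.- + l ℤ.+ + i)
          ≡ sgn l * (poch (q ^ (m ℕ.+ 1)) q i ⊘ poch q q i)
              * phi21 q i (q ^ (m ∸ l ℕ.+ 1)) (q ^ (m ℕ.+ 1)) (q ^ (i ℕ.+ 1)))
     × (Sgen q l m i (λ j → + j ℤ.- + 1)
          ≡ sgn l * (poch (q ^ (m ℕ.+ i ∸ l ℕ.+ 2)) q (l ∸ 1) ⊘ poch q q (l ∸ 1))
              * phi21 q (l ∸ 1) (q ^ (m ∸ l ℕ.+ 1)) (q ^ (m ℕ.+ i ∸ l ℕ.+ 2)) (q ^ l))
     × (Sgen q l m i (λ j → + j ℤ.- + 1 ℤ.- + l ℤ.+ + i)
          ≡ sgn l * (poch (q ^ (m ℕ.+ 2)) q (i ∸ 1) ⊘ poch q q (i ∸ 1))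
              * phi21 q (i ∸ 1) (q ^ (m ∸ l ℕ.+ 1)) (q ^ (m ℕ.+ 2)) (q ^ i))
lemma5p1 p e p-prime 1≤e n l i 1≤l 2l≤n 1≤i i≤l =
    Sgen≡phi21 q 1<q _ 0 l (ℕₚ.+-identityʳ l) l≤m (λ j → sym (ℤₚ.⊖-≥ ℕ.z≤n)) refl refl
  , Sgen≡phi21 q 1<q _ (l ∸ i) i (ℕₚ.m+[n∸m]≡n i≤l) l≤m (λ j → +j-l+i≡j⊖[l∸i] j i≤l)
      (cong (ℕ._+ 1) (sym (ℕₚ.m+n∸n≡m m i))) refl
  , Sgen≡phi21 q 1<q _ 1 (l ∸ 1) (ℕₚ.m∸n+n≡m 1≤l) l≤m (λ j → ℤₚ.[+m]-[+n]≡m⊖n j 1)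
      (x∸n+2≡x∸[n∸1]+1 1≤l (ℕₚ.≤-trans l≤m (ℕₚ.m≤m+n m i))) (sym (ℕₚ.m∸n+n≡m 1≤l))
  , Sgen≡phi21 q 1<q _ (1 ℕ.+ (l ∸ i)) (i ∸ 1) [i∸1]+[1+l∸i]≡l l≤m (λ j → +j-1-l+i≡j⊖[1+l∸i] j i≤l)
      (trans (cong (ℕ._+ 2) (sym (ℕₚ.m+n∸n≡m m i))) (x∸n+2≡x∸[n∸1]+1 1≤i (ℕₚ.m≤n+m i m)))
      (sym (ℕₚ.m∸n+n≡m 1≤i))
  where
  q = ℕ→ℚ (p ℕ.^ e)
  m = n ∸ l
  1<q : 1ℚ < q
  1<q = 1<n⇒1<ℕ→ℚn (ℕₚ.^-monoʳ-< p (ℕ.nonTrivial⇒n>1 p {{prime⇒nonTrivial p-prime}}) 1≤e)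
  l≤m : l ≤ m
  l≤m = ℕₚ.m+n≤o⇒m≤o∸n l (subst (ℕ._≤ n) (cong (l ℕ.+_) (ℕₚ.+-identityʳ l)) 2l≤n)
  [i∸1]+[1+l∸i]≡l : i ∸ 1 ℕ.+ (1 ℕ.+ (l ∸ i)) ≡ l
  [i∸1]+[1+l∸i]≡l = trans (sym (ℕₚ.+-assoc (i ∸ 1) 1 (l ∸ i)))
                          (trans (cong (ℕ._+ (l ∸ i)) (ℕₚ.m∸n+n≡m 1≤i)) (ℕₚ.m+[n∸m]≡n i≤l))
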